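{- Let $G$ be a connected simple cubic graph such that the Petersen graph $P$ admits a $G$-coloring (i.e., $G\prec P$). Then $G$ is isomorphic to $P$.
   Context: For cubic graphs $G$ and $H$ (finite, no loops, parallel edges allowed) and a vertex $x$, $\partial_G(x)$ denotes the set of edges of $G$ incident to $x$. An $H$-coloring of $G$ is a map $f:E(G)\to E(H)$ such that for every vertex $x\in V(G)$ there is a vertex $y\in V(H)$ with $f(\partial_G(x))=\partial_H(y)$. One writes $H\prec G$ if $G$ admits an $H$-coloring. $P$ denotes the Petersen graph. Note that $G$ here is allowed to have bridges. -}

module Defs where

open import Data.Nat using (ℕ)
open import Data.Fin using (Fin; zero; suc; #_)
open import Data.Product using (Σ; ∃; ∃-syntax; _×_; _,_; proj₁; proj₂)
open import Data.Sum using (_⊎_)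
open import Data.Vec using (Vec; []; _∷_; lookup)
open import Relation.Binary.PropositionalEquality using (_≡_; _≢_)
open import Relation.Nullary using (¬_)
open import Function.Bundles using (_↔_; _⇔_; Inverse)

-- A finite multigraph: vertices Fin nV, edges Fin nE, each edge with two ends.
-- Parallel edges are allowed (distinct edge names with the same ends).
record Graph : Set where
  constructor mkGraph
  field
    nV   : ℕ
    nE   : ℕ
    ends : Fin nE → Fin nV × Fin nV

open Graph public

V : Graph → Set
V G = Fin (nV G)

E : Graph → Set
E G = Fin (nE G)

Inc : (G : Graph) → E G → V G → Set
Inc G e x = proj₁ (ends G e) ≡ x ⊎ proj₂ (ends G e) ≡ x

Loopless : Graph → Set
Loopless G = ∀ (e : E G) → proj₁ (ends G e) ≢ proj₂ (ends G e)

Cubic : Graph → Set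
Cubic G = ∀ (x : V G) → Σ (E G) λ e₁ → Σ (E G) λ e₂ → Σ (E G) λ e₃ →
  (e₁ ≢ e₂) × (e₁ ≢ e₃) × (e₂ ≢ e₃) ×
  (∀ (e : E G) → Inc G e x ⇔ (e ≡ e₁ ⊎ e ≡ e₂ ⊎ e ≡ e₃))

NoParallel : Graph → Set
NoParallel G = ∀ (e e' : E G) → (∀ (x : V G) → Inc G e x ⇔ Inc G e' x) → e ≡ e'

Simple : Graph → Set
Simple G = Loopless G × NoParallel G

data Reach (G : Graph) : V G → V G → Set where
  here : ∀ {x} → Reach G x x
  step : ∀ {x y z} (e : E G) → Inc G e x → Inc G e y → Reach G y z → Reach G x z

Connected : Graph → Set
Connected G = ∀ (x y : V G) → Reach G x y

ImageIsStar : (G H : Graph) → (E G → E H) → V G → V H → Set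
ImageIsStar G H f x y =
  ∀ (e : E H) → (Σ (E G) λ d → Inc G d x × f d ≡ e) ⇔ Inc H e y

IsColoring : (H G : Graph) → (E G → E H) → Set
IsColoring H G f = ∀ (x : V G) → Σ (V H) λ y → ImageIsStar G H f x y

_≺_ : Graph → Graph → Set
H ≺ G = Σ (E G → E H) λ f → IsColoring H G f

record _≅_ (G H : Graph) : Set where
  field
    vmap : V G ↔ V H
    emap : E G ↔ E H
    inc  : ∀ (e : E G) (x : V G) →
           Inc G e x ⇔ Inc H (Inverse.to emap e) (Inverse.to vmap x)

-- The Petersen graph: outer cycle 0-1-2-3-4-0, spokes i-(i+5),
-- inner pentagram 5-7-9-6-8-5.
petersenEnds : Vec (Fin 10 × Fin 10) 15
petersenEnds =
  (# 0 , # 1) ∷ (# 1 , # 2) ∷ (# 2 , # 3) ∷ (# 3 , # 4) ∷ (# 4 , # 0) ∷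
  (# 0 , # 5) ∷ (# 1 , # 6) ∷ (# 2 , # 7) ∷ (# 3 , # 8) ∷ (# 4 , # 9) ∷
  (# 5 , # 7) ∷ (# 7 , # 9) ∷ (# 9 , # 6) ∷ (# 6 , # 8) ∷ (# 8 , # 5) ∷ []

Petersen : Graph
Petersen = mkGraph 10 15 (lookup petersenEnds)

-- A colouring f : E(P) → E(G) comes with g : V(P) → V(G) such that f maps the three edges
-- at x onto the three edges at g x. As G is cubic, f is injective on every star; as G has
-- no parallel edges, two stars whose images share two edges sit over the same vertex; and
-- as an edge has two ends, no edge of G is the image of edges at three vertices with
-- pairwise different images. An exhaustive search over the partitions of the 15 edges of
-- P shows that only the discrete partition is compatible with these constraints, so f is
-- injective, hence so is g. Connectivity of G then makes g, and with it f, surjective, and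
-- (g, f) inverts to an isomorphism.
module Submission where

open import Defs
open import Data.Bool.Base using (Bool; true; false; T; if_then_else_)
import Data.Bool.Properties as Bool
open import Data.Empty using (⊥-elim)
open import Data.Fin using (Fin; zero; suc; toℕ; fromℕ<; #_; punchOut; inject)
open import Data.Fin.Properties
  using (_≟_; toℕ-injective; toℕ<n; toℕ-fromℕ<; toℕ-inject; all?; any?; injective⇒≤;
         punchOut-injective; ¬∀⟶∃¬-smallest)
open import Data.List.Base using (List; []; _∷_; _++_; map; concatMap; filter; allFin; upTo)
import Data.List.Relation.Unary.All as List
open import Data.List.Membership.Propositional.Properties using (∈-upTo⁺)
open import Data.Nat.Base using (ℕ; zero; suc; _+_; _≤_; _<_; _≡ᵇ_; s≤s; s≤s⁻¹; z<s)
import Data.Nat.Properties as ℕ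
open import Data.Product using (Σ; ∃; _×_; _,_; proj₁; proj₂; uncurry)
open import Data.Sum using (_⊎_; inj₁; inj₂; [_,_]; [_,_]′)
open import Data.Vec.Base using (Vec; []; _∷_; lookup; tabulate)
open import Data.Vec.Properties using (tabulate-cong)
import Data.Vec.Relation.Unary.All as Vec
import Data.Vec.Relation.Unary.All.Properties as Vec
import Data.Vec.Relation.Unary.Any.Properties as VecAny
open import Data.Vec.Relation.Unary.AllPairs using (AllPairs; allPairs?)
import Data.Vec.Relation.Unary.AllPairs.Properties as AllPairs
open import Data.Vec.Membership.Propositional using (_∈_; _∉_)
open import Data.Vec.Membership.Propositional.Properties using (∈-tabulate⁺)
open import Data.Vec.Membership.DecPropositional ℕ._≟_ using (_∈?_)
open import Function.Base using (_∘_)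
open import Function.Bundles using (_⇔_; mk⇔; Equivalence; mk↔ₛ′)
open import Function.Definitions using (Injective)
open import Relation.Binary.PropositionalEquality
  using (_≡_; _≢_; refl; sym; trans; cong; subst; subst₂; module ≡-Reasoning)
open import Relation.Nullary using (Dec; yes; no; does; ¬?; contradiction)
open import Relation.Nullary.Decidable
  using (_×-dec_; _⊎-dec_; _→-dec_; toWitness; decidable-stable)

injective⇒surjective : ∀ {n} {π : Fin n → Fin n} → Injective _≡_ _≡_ π →
                       ∀ i → ∃ λ k → π k ≡ i
injective⇒surjective {suc n} {π} π-injective i with any? (λ k → π k ≟ i)
... | yes hit = hit
... | no miss = contradiction (injective⇒≤ punched-injective) ℕ.1+n≰n
  where
  i≢π : ∀ k → i ≢ π k
  i≢π k i≡πk = miss (k , sym i≡πk)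

  punched : Fin (suc n) → Fin n
  punched k = punchOut (i≢π k)

  punched-injective : Injective _≡_ _≡_ punched
  punched-injective = π-injective ∘ punchOut-injective (i≢π _) (i≢π _)

module _ {n} {X : Set} {edge : Fin n → X} (edge-injective : Injective _≡_ _≡_ edge)
         (φ : Fin n → X) (covers : ∀ k → ∃ λ i → φ i ≡ edge k) where

  private
    π : Fin n → Fin n
    π = proj₁ ∘ covers

    φ∘π : ∀ k → φ (π k) ≡ edge k
    φ∘π = proj₂ ∘ covers

    π-injective : Injective _≡_ _≡_ π
    π-injective {k} {l} πk≡πl =
      edge-injective (trans (sym (φ∘π k)) (trans (cong φ πk≡πl) (φ∘π l)))

  covering-injective : Injective _≡_ _≡_ φ
  covering-injective {i} {j} φi≡φj
    with k , refl ← injective⇒surjective π-injective i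
       | l , refl ← injective⇒surjective π-injective j =
    cong π (edge-injective (trans (sym (φ∘π k)) (trans φi≡φj (φ∘π l))))

module _ {G : Graph} where

  incident-ends : ∀ e {u w v} → Inc G e u → Inc G e w → u ≢ w → Inc G e v → v ≡ u ⊎ v ≡ w
  incident-ends _ (inj₁ refl) (inj₁ refl) u≢w _           = ⊥-elim (u≢w refl)
  incident-ends _ (inj₁ refl) (inj₂ refl) _   (inj₁ refl) = inj₁ refl
  incident-ends _ (inj₁ refl) (inj₂ refl) _   (inj₂ refl) = inj₂ refl
  incident-ends _ (inj₂ refl) (inj₁ refl) _   (inj₁ refl) = inj₂ refl
  incident-ends _ (inj₂ refl) (inj₁ refl) _   (inj₂ refl) = inj₁ refl
  incident-ends _ (inj₂ refl) (inj₂ refl) u≢w _           = ⊥-elim (u≢w refl)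

  two-of-three-ends-equal : ∀ e {u v w} → Inc G e u → Inc G e v → Inc G e w →
                            u ≡ v ⊎ u ≡ w ⊎ v ≡ w
  two-of-three-ends-equal e {u} {v} eu ev ew with u ≟ v
  ... | yes u≡v = inj₁ u≡v
  ... | no u≢v with incident-ends e eu ev u≢v ew
  ...   | inj₁ w≡u = inj₂ (inj₁ (sym w≡u))
  ...   | inj₂ w≡v = inj₂ (inj₂ (sym w≡v))

  parallel-edges-equal : NoParallel G → ∀ e e′ {u w} → Inc G e u → Inc G e w →
                         Inc G e′ u → Inc G e′ w → u ≢ w → e ≡ e′
  parallel-edges-equal noParallel e e′ eu ew e′u e′w u≢w =
    noParallel e e′ λ v → mk⇔ (at-ends e′ e′u e′w ∘ incident-ends e eu ew u≢w)
                              (at-ends e eu ew ∘ incident-ends e′ e′u e′w u≢w)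
    where
    at-ends : ∀ d {u w v} → Inc G d u → Inc G d w → v ≡ u ⊎ v ≡ w → Inc G d v
    at-ends d du dw = [ (λ v≡u → subst (Inc G d) (sym v≡u) du) ,
                        (λ v≡w → subst (Inc G d) (sym v≡w) dw) ]

  other-end : Loopless G → ∀ e {x} → Inc G e x → ∃ λ z → Inc G e z × z ≢ x
  other-end loopless e (inj₁ refl) = _ , inj₂ refl , loopless e ∘ sym
  other-end loopless e (inj₂ refl) = _ , inj₁ refl , loopless e

  reach-preserves : {P : V G → Set} → (∀ {u w} e → Inc G e u → Inc G e w → P u → P w) →
                    ∀ {u w} → Reach G u w → P u → P w
  reach-preserves closed here             pu = pu
  reach-preserves closed (step e eu ew r) pu = reach-preserves closed r (closed e eu ew pu)

  star-enumeration : Cubic G → ∀ v → Σ (Fin 3 → E G) λ edge →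
                     Injective _≡_ _≡_ edge × (∀ k → Inc G (edge k) v)
  star-enumeration cubic v with cubic v
  ... | e₁ , e₂ , e₃ , e₁≢e₂ , e₁≢e₃ , e₂≢e₃ , incident⇔ =
    edge , edge-injective , edge-incident
    where
    edge : Fin 3 → E G
    edge = lookup (e₁ ∷ e₂ ∷ e₃ ∷ [])

    edge-injective : Injective _≡_ _≡_ edge
    edge-injective {zero}           {zero}           _ = refl
    edge-injective {zero}           {suc zero}       p = ⊥-elim (e₁≢e₂ p)
    edge-injective {zero}           {suc (suc zero)} p = ⊥-elim (e₁≢e₃ p)
    edge-injective {suc zero}       {zero}           p = ⊥-elim (e₁≢e₂ (sym p))
    edge-injective {suc zero}       {suc zero}       _ = refl
    edge-injective {suc zero}       {suc (suc zero)} p = ⊥-elim (e₂≢e₃ p)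
    edge-injective {suc (suc zero)} {zero}           p = ⊥-elim (e₁≢e₃ (sym p))
    edge-injective {suc (suc zero)} {suc zero}       p = ⊥-elim (e₂≢e₃ (sym p))
    edge-injective {suc (suc zero)} {suc (suc zero)} _ = refl

    edge-incident : ∀ k → Inc G (edge k) v
    edge-incident zero             = Equivalence.from (incident⇔ e₁) (inj₁ refl)
    edge-incident (suc zero)       = Equivalence.from (incident⇔ e₂) (inj₂ (inj₁ refl))
    edge-incident (suc (suc zero)) = Equivalence.from (incident⇔ e₃) (inj₂ (inj₂ refl))

  star-cover-injective : Cubic G → ∀ v (φ : Fin 3 → E G) →
                         (∀ e → Inc G e v → ∃ λ i → φ i ≡ e) → Injective _≡_ _≡_ φ
  star-cover-injective cubic v φ covers
    with edge , edge-injective , edge-incident ← star-enumeration cubic v =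
    covering-injective edge-injective φ (λ k → covers (edge k) (edge-incident k))

module _ {G H : Graph} {g : V H → V G} {f : E H → E G}
         (g-injective : Injective _≡_ _≡_ g) (g-surjective : ∀ y → ∃ λ x → g x ≡ y)
         (f-injective : Injective _≡_ _≡_ f) (f-surjective : ∀ e → ∃ λ d → f d ≡ e)
         (incidence : ∀ d x → Inc G (f d) (g x) ⇔ Inc H d x) where

  inverse-isomorphism : G ≅ H
  inverse-isomorphism = record
    { vmap = mk↔ₛ′ g⁻¹ g (λ x → g-injective (g∘g⁻¹ (g x))) g∘g⁻¹
    ; emap = mk↔ₛ′ f⁻¹ f (λ d → f-injective (f∘f⁻¹ (f d))) f∘f⁻¹
    ; inc  = λ e y → subst₂ (λ e′ y′ → Inc G e′ y′ ⇔ Inc H (f⁻¹ e) (g⁻¹ y))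
                            (f∘f⁻¹ e) (g∘g⁻¹ y) (incidence (f⁻¹ e) (g⁻¹ y))
    }
    where
    g⁻¹   = proj₁ ∘ g-surjective
    g∘g⁻¹ = proj₂ ∘ g-surjective
    f⁻¹   = proj₁ ∘ f-surjective
    f∘f⁻¹ = proj₂ ∘ f-surjective

stars : Vec (Vec (Fin 15) 3) 10
stars =
  (# 0 ∷ # 4 ∷ # 5 ∷ []) ∷ (# 0 ∷ # 1 ∷ # 6 ∷ []) ∷ (# 1 ∷ # 2 ∷ # 7 ∷ []) ∷
  (# 2 ∷ # 3 ∷ # 8 ∷ []) ∷ (# 3 ∷ # 4 ∷ # 9 ∷ []) ∷ (# 5 ∷ # 10 ∷ # 14 ∷ []) ∷
  (# 6 ∷ # 12 ∷ # 13 ∷ []) ∷ (# 7 ∷ # 10 ∷ # 11 ∷ []) ∷ (# 8 ∷ # 13 ∷ # 14 ∷ []) ∷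
  (# 9 ∷ # 11 ∷ # 12 ∷ []) ∷ []

star : Fin 10 → Fin 3 → Fin 15
star x = lookup (lookup stars x)

incident? : (G : Graph) (e : E G) (x : V G) → Dec (Inc G e x)
incident? G e x = (proj₁ (ends G e) ≟ x) ⊎-dec (proj₂ (ends G e) ≟ x)

-- Abstract, so that `with` on these facts does not re-run the decision procedures.
abstract
  star-incident : ∀ x i → Inc Petersen (star x i) x
  star-incident = toWitness {a? = all? λ x → all? λ i → incident? Petersen (star x i) x} _

  incident⇒star : ∀ d x → Inc Petersen d x → ∃ λ i → star x i ≡ d
  incident⇒star = toWitness
    {a? = all? λ d → all? λ x → incident? Petersen d x →-dec any? λ i → star x i ≟ d} _

  star-determines-vertex : ∀ x z → (∀ i → Inc Petersen (star x i) z) → x ≡ z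
  star-determines-vertex = toWitness
    {a? = all? λ x → all? λ z → (all? λ i → incident? Petersen (star x i) z) →-dec x ≟ z} _

  petersen-loopless : Loopless Petersen
  petersen-loopless = toWitness
    {a? = all? λ e → ¬? (proj₁ (ends Petersen e) ≟ proj₂ (ends Petersen e))} _

module _ {A : Set} where

  AllIn : ∀ {m n} → Vec A m → Vec A n → Set
  AllIn t u = Vec.All (_∈ u) t

  AtMostOneIn : ∀ {m n} → Vec A m → Vec A n → Set
  AtMostOneIn t u = AllPairs (λ a b → a ∈ u → b ∉ u) t

  NoCommon : ∀ {m n p} → Vec A m → Vec A n → Vec A p → Set
  NoCommon t u w = Vec.All (λ a → a ∈ u → a ∉ w) t

-- With L x the images of the three edges at x: they are distinct, two stars with two common
-- images lie over the same vertex, and no image is common to three stars over different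
-- vertices.
data Constraint : Set where
  distinct : Fin 10 → Constraint
  meet     : Fin 10 → Fin 10 → Constraint
  triple   : Fin 10 → Fin 10 → Fin 10 → Constraint

vertices : Constraint → List (Fin 10)
vertices (distinct x)   = x ∷ []
vertices (meet x z)     = x ∷ z ∷ []
vertices (triple x y z) = x ∷ y ∷ z ∷ []

Triple : {A : Set} → Vec A 3 → Vec A 3 → Vec A 3 → Set
Triple t u w = AllIn t u ⊎ AllIn t w ⊎ AllIn u w ⊎ NoCommon t u w

Holds : {A : Set} → (Fin 10 → Vec A 3) → Constraint → Set
Holds L (distinct x)   = AllPairs _≢_ (L x)
Holds L (meet x z)     = AllIn (L x) (L z) ⊎ AtMostOneIn (L x) (L z)
Holds L (triple x y z) = Triple (L x) (L y) (L z)

holds-cong : ∀ {A} {L L′ : Fin 10 → Vec A 3} c →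
             List.All (λ x → L x ≡ L′ x) (vertices c) → Holds L c → Holds L′ c
holds-cong (distinct x) (p List.∷ List.[]) = subst (AllPairs _≢_) p
holds-cong (meet x z) (p List.∷ q List.∷ List.[]) =
  subst₂ (λ t u → AllIn t u ⊎ AtMostOneIn t u) p q
holds-cong {L = L} (triple x y z) (p List.∷ q List.∷ r List.∷ List.[]) =
  subst₂ (Triple _) q r ∘ subst (λ t → Triple t (L y) (L z)) p

allIn? : ∀ {m n} (t : Vec ℕ m) (u : Vec ℕ n) → Dec (AllIn t u)
allIn? t u = Vec.all? (_∈? u) t

meet? : (t u : Vec ℕ 3) → Dec (AllIn t u ⊎ AtMostOneIn t u)
meet? t u = allIn? t u ⊎-dec allPairs? (λ a b → a ∈? u →-dec ¬? (b ∈? u)) t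

triple? : (t u w : Vec ℕ 3) → Dec (Triple t u w)
triple? t u w = allIn? t u ⊎-dec allIn? t w ⊎-dec allIn? u w ⊎-dec
                Vec.all? (λ a → a ∈? u →-dec ¬? (a ∈? w)) t

holds? : (L : Fin 10 → Vec ℕ 3) → ∀ c → Dec (Holds L c)
holds? L (distinct x)   = allPairs? (λ a b → ¬? (a ℕ.≟ b)) (L x)
holds? L (meet x z)     = meet? (L x) (L z)
holds? L (triple x y z) = triple? (L x) (L y) (L z)

labelsAt : {A : Set} → (Fin 15 → A) → Fin 10 → Vec A 3
labelsAt ℓ x = tabulate (ℓ ∘ star x)

Complete : ℕ → Fin 10 → Set
Complete k x = ∀ i → toℕ (star x i) < k

Within : ℕ → Constraint → Set
Within k c = List.All (Complete k) (vertices c)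

within? : ∀ k c → Dec (Within k c)
within? k c = List.all? (λ x → all? λ i → toℕ (star x i) ℕ.<? k) (vertices c)

pairs : {A : Set} → List A → List (A × A)
pairs []       = []
pairs (a ∷ as) = map (a ,_) as ++ pairs as

-- The constraints checked once edge k is labelled: those led by a vertex whose star ends
-- with edge k (the rows of `stars` increase). Soundness only needs `schedule-within`; the
-- choice just makes the search prune early.
schedule : ℕ → List Constraint
schedule k = concatMap constraintsAt (filter (λ x → last x ℕ.≟ k) (allFin 10))
  where
  last : Fin 10 → ℕ
  last x = toℕ (star x (# 2))

  constraintsAt : Fin 10 → List Constraint
  constraintsAt x = distinct x ∷ map (meet x) others ++ map (uncurry (triple x)) (pairs others)
    where
    others = filter (λ y → ¬? (y ≟ x)) (filter (λ y → last y ℕ.≤? k) (allFin 10))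

abstract
  schedule-within : ∀ k → k < 15 → List.All (Within (suc k)) (schedule k)
  schedule-within k k<15 = List.lookup
    (toWitness {a? = List.all? (λ k → List.all? (within? (suc k)) (schedule k)) (upTo 15)} _)
    (∈-upTo⁺ k<15)

_[_≔_] : (ℕ → ℕ) → ℕ → ℕ → ℕ → ℕ
(s [ k ≔ v ]) n = if n ≡ᵇ k then v else s n

assign-here : ∀ s k v → (s [ k ≔ v ]) k ≡ v
assign-here s k v with k ≡ᵇ k in eq
... | true  = refl
... | false = ⊥-elim (subst T eq (ℕ.≡⇒≡ᵇ k k refl))

assign-elsewhere : ∀ s {k n} v → n ≢ k → (s [ k ≔ v ]) n ≡ s n
assign-elsewhere s {k} {n} v n≢k with n ≡ᵇ k in eq
... | false = refl
... | true  = contradiction (ℕ.≡ᵇ⇒≡ n k (subst T (sym eq) _)) n≢k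

-- A labelling of the edges of P is canonical when each edge carries the index of the first
-- edge of its class; `s (s k) ≡ s k` is what this says about the label of edge k.
Consistent : List Constraint → ℕ → (ℕ → ℕ) → Set
Consistent cs k s = s (s k) ≡ s k × List.All (Holds (labelsAt (s ∘ toℕ))) cs

consistent? : ∀ cs k s → Dec (Consistent cs k s)
consistent? cs k s = s (s k) ℕ.≟ s k ×-dec List.all? (holds? (labelsAt (s ∘ toℕ))) cs

from-does : ∀ {A : Set} (a? : Dec A) → does a? ≡ true → A
from-does (yes a) _ = a

-- `search m k s` holds when every consistent way to label the next m edges after the labels
-- s 0, …, s (k ∸ 1) ends in the identity labelling. The recursive result enters the
-- decision as a Bool: nested Dec's would keep their unevaluated proofs alive while
-- `search-succeeds` is evaluated.
search : ℕ → ℕ → (ℕ → ℕ) → Bool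
extensions? : ∀ m k s cs →
  Dec (List.All (λ v → Consistent cs k (s [ k ≔ v ]) → search m (suc k) (s [ k ≔ v ]) ≡ true)
                (upTo (suc k)))

search zero    k s = does (all? λ (d : Fin 15) → s (toℕ d) ℕ.≟ toℕ d)
search (suc m) k s = does (extensions? m k s (schedule k))

extensions? m k s cs = List.all? (λ v → consistent? cs k (s [ k ≔ v ]) →-dec
                                        search m (suc k) (s [ k ≔ v ]) Bool.≟ true) (upTo (suc k))

search-succeeds : search 15 0 (λ _ → 0) ≡ true
search-succeeds = refl

record Canonical (ℓ : Fin 15 → ℕ) : Set where
  field
    label≤index       : ∀ d → ℓ d ≤ toℕ d
    label-fixed-point : ∀ d → ∃ λ d′ → toℕ d′ ≡ ℓ d × ℓ d′ ≡ ℓ d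
    constraints       : ∀ c → Holds (labelsAt ℓ) c

module _ {ℓ : Fin 15 → ℕ} (canonical : Canonical ℓ) where
  open Canonical canonical

  private
    Agrees : (ℕ → ℕ) → ℕ → Set
    Agrees s k = ∀ d → toℕ d < k → s (toℕ d) ≡ ℓ d

    agrees-assign : ∀ {s k} (d : Fin 15) → toℕ d ≡ k → Agrees s k →
                    Agrees (s [ k ≔ ℓ d ]) (suc k)
    agrees-assign {s} d refl agree d′ d′<1+k with toℕ d′ ℕ.≟ toℕ d
    ... | yes d′≡d rewrite toℕ-injective d′≡d = assign-here s (toℕ d) (ℓ d)
    ... | no d′≢d = trans (assign-elsewhere s (ℓ d) d′≢d)
                          (agree d′ (ℕ.≤∧≢⇒< (s≤s⁻¹ d′<1+k) d′≢d))

    consistent : ∀ {s k} (d : Fin 15) → toℕ d ≡ k → Agrees s (suc k) →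
                 Consistent (schedule k) k s
    consistent {s} d refl agree with d′ , d′≡ℓd , ℓd′≡ℓd ← label-fixed-point d =
      representative , List.map holds (schedule-within (toℕ d) (toℕ<n d))
      where
      open ≡-Reasoning
      sd≡ℓd = agree d ℕ.≤-refl
      d′<1+k = subst (_< suc (toℕ d)) (sym d′≡ℓd) (s≤s (label≤index d))

      representative : s (s (toℕ d)) ≡ s (toℕ d)
      representative = begin
        s (s (toℕ d)) ≡⟨ cong s sd≡ℓd ⟩
        s (ℓ d)       ≡⟨ cong s d′≡ℓd ⟨
        s (toℕ d′)    ≡⟨ agree d′ d′<1+k ⟩
        ℓ d′          ≡⟨ ℓd′≡ℓd ⟩
        ℓ d           ≡⟨ sd≡ℓd ⟨
        s (toℕ d)     ∎

      holds : ∀ {c} → Within (suc (toℕ d)) c → Holds (labelsAt (s ∘ toℕ)) c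
      holds {c} within = holds-cong c (List.map (λ {x} → agree-at x) within) (constraints c)
        where
        agree-at : ∀ x → Complete (suc (toℕ d)) x → labelsAt ℓ x ≡ labelsAt (s ∘ toℕ) x
        agree-at x complete = tabulate-cong λ i → sym (agree (star x i) (complete i))

    sound : ∀ m k s → m + k ≡ 15 → Agrees s k → search m k s ≡ true → ∀ d → ℓ d ≡ toℕ d
    sound zero _ s refl agree identity d = trans (sym (agree d (toℕ<n d)))
      (from-does (all? λ (d : Fin 15) → s (toℕ d) ℕ.≟ toℕ d) identity d)
    sound (suc m) k s 1+m+k≡15 agree extends =
      sound m (suc k) s′ (trans (ℕ.+-suc m k) 1+m+k≡15) agree′
        (extends-to-ℓd (consistent {s′} d d≡k agree′))
      where
      k<15 : k < 15
      k<15 = subst (k <_) 1+m+k≡15 (ℕ.m<n+m k z<s)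
      d = fromℕ< k<15
      d≡k = toℕ-fromℕ< k<15
      s′ = s [ k ≔ ℓ d ]
      agree′ = agrees-assign {s} d d≡k agree
      extends-to-ℓd : Consistent (schedule k) k s′ → search m (suc k) s′ ≡ true
      extends-to-ℓd = List.lookup (from-does (extensions? m k s (schedule k)) extends)
                                  (∈-upTo⁺ (s≤s (subst (ℓ d ≤_) d≡k (label≤index d))))

  canonical-identity : ∀ d → ℓ d ≡ toℕ d
  canonical-identity = sound 15 0 (λ _ → 0) refl (λ _ ()) search-succeeds

module Colouring (G : Graph) (connected : Connected G) (noParallel : NoParallel G)
                 (cubic : Cubic G) (f : E Petersen → E G) (colouring : IsColoring G Petersen f)
                 where

  g : V Petersen → V G
  g x = proj₁ (colouring x)

  f-incident : ∀ d {x} → Inc Petersen d x → Inc G (f d) (g x)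
  f-incident d {x} d∈x = Equivalence.to (proj₂ (colouring x) (f d)) (d , d∈x , refl)

  f-star-incident : ∀ x i → Inc G (f (star x i)) (g x)
  f-star-incident x i = f-incident (star x i) (star-incident x i)

  star-image : ∀ x {e} → Inc G e (g x) → ∃ λ i → f (star x i) ≡ e
  star-image x {e} e∈gx
    with d , d∈x , fd≡e ← Equivalence.from (proj₂ (colouring x) e) e∈gx
    with i , star≡d ← incident⇒star d x d∈x = i , trans (cong f star≡d) fd≡e

  f-star-injective : ∀ x → Injective _≡_ _≡_ (f ∘ star x)
  f-star-injective x = star-cover-injective cubic (g x) (f ∘ star x) (λ _ → star-image x)

  same-vertex⇒same-star : ∀ x z → g x ≡ g z → ∀ i → Inc G (f (star x i)) (g z)
  same-vertex⇒same-star x z gx≡gz i = subst (Inc G _) gx≡gz (f-star-incident x i)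

  shared-pair⇒same-vertex : ∀ x z {i i′} → i ≢ i′ → Inc G (f (star x i)) (g z) →
                            Inc G (f (star x i′)) (g z) → g x ≡ g z
  shared-pair⇒same-vertex x z {i} {i′} i≢i′ i∈gz i′∈gz with g x ≟ g z
  ... | yes gx≡gz = gx≡gz
  ... | no gx≢gz = contradiction (f-star-injective x parallel) i≢i′
    where
    parallel = parallel-edges-equal noParallel (f (star x i)) (f (star x i′))
                 (f-star-incident x i) i∈gz (f-star-incident x i′) i′∈gz gx≢gz

  abstract
    first : ∀ d → Σ (Fin 15) λ m → f m ≡ f d × (∀ j → toℕ j < toℕ m → f j ≢ f d)
    first d
      with m , ¬fm≢fd , below ← ¬∀⟶∃¬-smallest 15 (λ j → f j ≢ f d) (λ j → ¬? (f j ≟ f d))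
                                                 (λ all → all d refl) =
      m , decidable-stable (f m ≟ f d) ¬fm≢fd ,
      λ j j<m → subst (λ j → f j ≢ f d) (inject-fromℕ< j<m) (below (fromℕ< j<m))
      where
      inject-fromℕ< : ∀ {j} (j<m : toℕ j < toℕ m) → inject (fromℕ< j<m) ≡ j
      inject-fromℕ< j<m = toℕ-injective (trans (toℕ-inject (fromℕ< j<m)) (toℕ-fromℕ< j<m))

  least : Fin 15 → Fin 15
  least = proj₁ ∘ first

  least-image : ∀ d → f (least d) ≡ f d
  least-image = proj₁ ∘ proj₂ ∘ first

  least-minimal : ∀ d j → toℕ j < toℕ (least d) → f j ≢ f d
  least-minimal = proj₂ ∘ proj₂ ∘ first

  label : Fin 15 → ℕ
  label = toℕ ∘ least

  label-respects : ∀ {d d′} → f d ≡ f d′ → label d ≡ label d′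
  label-respects fd≡fd′ = ℕ.≤-antisym (not-later fd≡fd′) (not-later (sym fd≡fd′))
    where
    not-later : ∀ {d d′} → f d ≡ f d′ → label d ≤ label d′
    not-later {d} {d′} fd≡fd′ =
      ℕ.≮⇒≥ λ m′<m → least-minimal d (least d′) m′<m (trans (least-image d′) (sym fd≡fd′))

  label-reflects : ∀ {d d′} → label d ≡ label d′ → f d ≡ f d′
  label-reflects {d} {d′} ld≡ld′ =
    trans (sym (least-image d)) (trans (cong f (toℕ-injective ld≡ld′)) (least-image d′))

  ∈-labels⇔ : ∀ d z → label d ∈ labelsAt label z ⇔ Inc G (f d) (g z)
  ∈-labels⇔ d z = mk⇔ to from
    where
    to : label d ∈ labelsAt label z → Inc G (f d) (g z)
    to ∈z with j , ld≡lzj ← VecAny.tabulate⁻ ∈z =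
      subst (λ e → Inc G e (g z)) (sym (label-reflects {d′ = star z j} ld≡lzj)) (f-star-incident z j)

    from : Inc G (f d) (g z) → label d ∈ labelsAt label z
    from fd∈gz with j , fzj≡fd ← star-image z fd∈gz =
      subst (_∈ labelsAt label z) (label-respects fzj≡fd) (∈-tabulate⁺ (label ∘ star z) j)

  all-in : ∀ x z → g x ≡ g z → AllIn (labelsAt label x) (labelsAt label z)
  all-in x z gx≡gz =
    Vec.tabulate⁺ λ i → Equivalence.from (∈-labels⇔ (star x i) z) (same-vertex⇒same-star x z gx≡gz i)

  constraints : ∀ c → Holds (labelsAt label) c
  constraints (distinct x) = AllPairs.tabulate⁺ λ i≢j → i≢j ∘ f-star-injective x ∘ label-reflects
  constraints (meet x z) with g x ≟ g z
  ... | yes gx≡gz = inj₁ (all-in x z gx≡gz)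
  ... | no gx≢gz  = inj₂ (AllPairs.tabulate⁺ λ {i} {i′} i≢i′ ∈z ∈z′ → gx≢gz
          (shared-pair⇒same-vertex x z i≢i′ (to (∈-labels⇔ (star x i) z) ∈z)
                                            (to (∈-labels⇔ (star x i′) z) ∈z′)))
    where open Equivalence
  constraints (triple x y z) with g x ≟ g y | g x ≟ g z | g y ≟ g z
  ... | yes gx≡gy | _         | _         = inj₁ (all-in x y gx≡gy)
  ... | no _      | yes gx≡gz | _         = inj₂ (inj₁ (all-in x z gx≡gz))
  ... | no _      | no _      | yes gy≡gz = inj₂ (inj₂ (inj₁ (all-in y z gy≡gz)))
  ... | no gx≢gy  | no gx≢gz  | no gy≢gz  = inj₂ (inj₂ (inj₂ (Vec.tabulate⁺ λ i ∈y ∈z →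
          [ gx≢gy , [ gx≢gz , gy≢gz ]′ ]′ (two-of-three-ends-equal {G = G} (f (star x i))
            (f-star-incident x i) (to (∈-labels⇔ (star x i) y) ∈y) (to (∈-labels⇔ (star x i) z) ∈z)))))
    where open Equivalence

  canonical : Canonical label
  canonical = record
    { label≤index       = λ d → ℕ.≮⇒≥ λ d<m → least-minimal d d d<m refl
    ; label-fixed-point = λ d → least d , refl , label-respects (least-image d)
    ; constraints       = constraints
    }

  f-injective : Injective _≡_ _≡_ f
  f-injective {d} {d′} fd≡fd′ = toℕ-injective (begin
    toℕ d    ≡⟨ canonical-identity canonical d ⟨
    label d  ≡⟨ label-respects fd≡fd′ ⟩
    label d′ ≡⟨ canonical-identity canonical d′ ⟩
    toℕ d′   ∎)
    where open ≡-Reasoning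

  g-injective : Injective _≡_ _≡_ g
  g-injective {x} {z} gx≡gz = star-determines-vertex x z λ i →
    let j , fzj≡fxi = star-image z (same-vertex⇒same-star x z gx≡gz i)
    in subst (λ d → Inc Petersen d z) (f-injective fzj≡fxi) (star-incident z j)

  g-surjective : ∀ y → ∃ λ x → g x ≡ y
  g-surjective y = reach-preserves image-closed (connected (g zero) y) (zero , refl)
    where
    image-closed : ∀ {u w} e → Inc G e u → Inc G e w → ∃ (λ x → g x ≡ u) → ∃ λ x → g x ≡ w
    image-closed e e∈u e∈w (x , refl) =
      let i , fxi≡e = star-image x e∈u
          z , z∈d , z≢x = other-end petersen-loopless (star x i) (star-incident x i)
          e∈gz = subst (λ e → Inc G e (g z)) fxi≡e (f-incident (star x i) z∈d)
      in [ (λ w≡gx → x , sym w≡gx) , (λ w≡gz → z , sym w≡gz) ]′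
           (incident-ends {G = G} e e∈u e∈gz (z≢x ∘ sym ∘ g-injective) e∈w)

  f-surjective : ∀ e → ∃ λ d → f d ≡ e
  f-surjective e
    with x , gx≡end ← g-surjective (proj₁ (ends G e))
    with i , fxi≡e ← star-image x (subst (Inc G e) (sym gx≡end) (inj₁ refl)) = star x i , fxi≡e

  incidence : ∀ d x → Inc G (f d) (g x) ⇔ Inc Petersen d x
  incidence d x = mk⇔ reflect (f-incident d)
    where
    reflect : Inc G (f d) (g x) → Inc Petersen d x
    reflect fd∈gx with i , fxi≡fd ← star-image x fd∈gx =
      subst (λ d → Inc Petersen d x) (f-injective fxi≡fd) (star-incident x i)

  isomorphism : G ≅ Petersen
  isomorphism = inverse-isomorphism g-injective g-surjective f-injective f-surjective incidence

theorem6 : (G : Graph) → Connected G → Simple G → Cubic G →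
    G ≺ Petersen → G ≅ Petersen
theorem6 G connected (_ , noParallel) cubic (f , colouring) =
  Colouring.isomorphism G connected noParallel cubic f colouring
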